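{- Let $G$ be a connected graph of order $n$. Then $\mathrm{sn}(G)=n-1$ if and only if $G=K_n$. Also $\overline{\mathrm{scs}}(G)=n-1$ if and only if $G=K_n$.
   Context: For a graph $G=(V,E)$ and an integer $k\ge\chi(G)$, a proper $k$-colouring is a map $c\colon V\to\{1,\dots,k\}$ with adjacent vertices receiving different colours. A determining set for $(G,c)$ is a set $S\subseteq V$ such that there is no proper $k$-colouring $c'\neq c$ of $G$ with $c'(s)=c(s)$ for all $s\in S$. A critical set for $(G,c)$ is an inclusion-minimal determining set. $\mathrm{scs}(G,c)$ denotes the minimum size of a critical set for $(G,c)$. $\mathrm{sn}(G,k)$ is the minimum of $\mathrm{scs}(G,c)$ over all proper $k$-colourings $c$ (equivalently, the minimum number of vertices coloured in a partial colouring that extends uniquely to a proper $k$-colouring), and $\overline{\mathrm{scs}}(G,k)$ is the maximum of $\mathrm{scs}(G,c)$ over all proper $k$-colourings $c$. When $k=\chi(G)$ we write $\mathrm{sn}(G)$ and $\overline{\mathrm{scs}}(G)$. -}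

module Defs where

open import Data.Nat using (ℕ; _≤_; _<_)
open import Data.Fin using (Fin)
open import Data.Fin.Subset using (Subset; _∈_; _⊆_; ∣_∣)
open import Data.Bool using (Bool; true; false)
open import Data.Product using (Σ; _×_; ∃-syntax)
open import Relation.Binary.PropositionalEquality using (_≡_; _≢_)
open import Relation.Nullary using (¬_)

record Graph (n : ℕ) : Set where
  field
    Adj    : Fin n → Fin n → Bool
    sym    : ∀ u v → Adj u v ≡ Adj v u
    irrefl : ∀ v → Adj v v ≡ false
open Graph public

Adjacent : ∀ {n} → Graph n → Fin n → Fin n → Set
Adjacent G u v = Adj G u v ≡ true

data Reach {n : ℕ} (G : Graph n) : Fin n → Fin n → Set where
  here : ∀ {v} → Reach G v v
  step : ∀ {u w v} → Adjacent G u w → Reach G w v → Reach G u v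

Connected : ∀ {n} → Graph n → Set
Connected {n} G = ∀ (u v : Fin n) → Reach G u v

IsComplete : ∀ {n} → Graph n → Set
IsComplete {n} G = ∀ (u v : Fin n) → u ≢ v → Adjacent G u v

Colouring : ℕ → ℕ → Set
Colouring n k = Fin n → Fin k

Proper : ∀ {n k} → Graph n → Colouring n k → Set
Proper G c = ∀ u v → Adjacent G u v → c u ≢ c v

Colourable : ∀ {n} → Graph n → ℕ → Set
Colourable {n} G k = Σ (Colouring n k) (Proper G)

IsChromaticNumber : ∀ {n} → Graph n → ℕ → Set
IsChromaticNumber G k = Colourable G k × (∀ m → m < k → ¬ Colourable G m)

Determining : ∀ {n k} → Graph n → Colouring n k → Subset n → Set
Determining {n} {k} G c S =
  ∀ (c' : Colouring n k) → Proper G c' →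
    (∀ s → s ∈ S → c' s ≡ c s) → ∀ v → c' v ≡ c v

Critical : ∀ {n k} → Graph n → Colouring n k → Subset n → Set
Critical G c S =
  Determining G c S × (∀ T → T ⊆ S → Determining G c T → T ≡ S)

ScsIs : ∀ {n k} → Graph n → Colouring n k → ℕ → Set
ScsIs G c m =
  (∃[ S ] (Critical G c S × ∣ S ∣ ≡ m)) × (∀ S → Critical G c S → m ≤ ∣ S ∣)

SnIs : ∀ {n} → Graph n → ℕ → ℕ → Set
SnIs {n} G k m =
  (∃[ c ] (Proper {n} {k} G c × ScsIs G c m)) ×
  (∀ (c : Colouring n k) m' → Proper G c → ScsIs G c m' → m ≤ m')

ScsBarIs : ∀ {n} → Graph n → ℕ → ℕ → Set
ScsBarIs {n} G k m =
  (∃[ c ] (Proper {n} {k} G c × ScsIs G c m)) ×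
  (∀ (c : Colouring n k) m' → Proper G c → ScsIs G c m' → m' ≤ m)

-- In K_n every proper colouring is a bijection onto the n colours, so a set of vertices
-- determines it exactly when it misses at most one vertex (two missing vertices can swap
-- colours); hence every critical set has n − 1 vertices. Conversely, in a χ-colouring every
-- colour class contains a b-vertex, one adjacent to all other colour classes, since otherwise
-- that class could be recoloured away. If G is connected but not complete, this yields
-- distinct x, y such that y is a b-vertex and x remains one after deleting y; then
-- V ∖ {x, y} determines the colouring, so some critical set has at most n − 2 vertices.
module Submission where

open import Defs hiding (sym)
open import Data.Bool using (true; false)
open import Data.Bool.Properties using () renaming (_≟_ to _≟ᵇ_)
open import Data.Empty using (⊥-elim)
open import Data.Fin using (Fin; zero; _≟_; punchOut)
open import Data.Fin.Properties
  using (any?; all?; ¬∀⟶∃¬; pigeonhole; <⇒≢; punchOut-injective)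
open import Data.Fin.Permutation.Components using (transpose; transpose-inverse)
open import Data.Fin.Subset using (_∈_; _∉_; _⊆_; _⊂_; ∣_∣; ∁; ⁅_⁆; _-_; ⊤)
open import Data.Fin.Subset.Properties
open import Data.Nat using (ℕ; zero; suc; _∸_; _≤_; _<_)
open import Data.Nat.Induction using (<-wellFounded)
import Data.Nat.Properties as ℕ
open import Data.Product using (∃-syntax; ∃₂; _×_; _,_; proj₁; proj₂)
open import Data.Vec using ([])
open import Function using (_∘_; id)
open import Function.Bundles using (_⇔_; mk⇔)
open import Function.Definitions using (Injective)
open import Induction.WellFounded using (Acc; acc)
open import Relation.Binary.PropositionalEquality
  using (_≡_; _≢_; refl; sym; trans; cong; subst; module ≡-Reasoning)
open import Relation.Nullary using (¬_; Dec; yes; no; contradiction)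
open import Relation.Nullary.Decidable
  using (¬?; _×-dec_; _→-dec_; dec-true; dec-false; decidable-stable; ¬¬-excluded-middle)

adjacent⇒≢ : ∀ {n} (G : Graph n) {u v} → Adjacent G u v → u ≢ v
adjacent⇒≢ G {u} uv refl = contradiction (trans (sym uv) (irrefl G u)) λ ()

injective⇒proper : ∀ {n k} (G : Graph n) {c : Colouring n k} →
                   Injective _≡_ _≡_ c → Proper G c
injective⇒proper G injective u v uv = adjacent⇒≢ G uv ∘ injective

chromatic≤order : ∀ {n} {G : Graph n} {χ} → IsChromaticNumber G χ → χ ≤ n
chromatic≤order {G = G} (_ , fewer-fail) =
  ℕ.≮⇒≥ λ n<χ → fewer-fail _ n<χ (id , injective⇒proper G id)

forced-colour : ∀ {n k} {G : Graph n} {c : Colouring n k} → Proper G c →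
                ∀ x b → (∀ a → a ≢ b → ∃[ z ] Adjacent G x z × c z ≡ a) → c x ≡ b
forced-colour {c = c} proper x b seen with c x ≟ b
... | yes cx≡b = cx≡b
... | no cx≢b =
  let z , xz , cz≡cx = seen (c x) cx≢b in contradiction (sym cz≡cx) (proper x z xz)

injective⇒surjective : ∀ {n k} → k ≤ n → (f : Fin n → Fin k) →
                       Injective _≡_ _≡_ f → ∀ a → ∃[ v ] f v ≡ a
injective⇒surjective {k = zero}  _   _ _         ()
injective⇒surjective {k = suc _} k≤n f injective a with any? (λ v → f v ≟ a)
... | yes hit = hit
... | no miss =
  let i , j , i<j , eq = pigeonhole k≤n (λ v → punchOut (a≢f v))
  in contradiction (injective (punchOut-injective (a≢f i) (a≢f j) eq)) (<⇒≢ i<j)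
  where
  a≢f : ∀ v → a ≢ f v
  a≢f v a≡fv = miss (v , sym a≡fv)

x∈∁⁅y⁆⁺ : ∀ {n} {x y : Fin n} → x ≢ y → x ∈ ∁ ⁅ y ⁆
x∈∁⁅y⁆⁺ = x∉p⇒x∈∁p ∘ x≢y⇒x∉⁅y⁆

x∈∁⁅y⁆⁻ : ∀ {n} {x y : Fin n} → x ∈ ∁ ⁅ y ⁆ → x ≢ y
x∈∁⁅y⁆⁻ = x∉⁅y⁆⇒x≢y ∘ x∈∁p⇒x∉p

∣∁⁅x⁆∣≡n∸1 : ∀ {n} (x : Fin n) → ∣ ∁ ⁅ x ⁆ ∣ ≡ n ∸ 1
∣∁⁅x⁆∣≡n∸1 {n} x = trans (∣∁p∣≡n∸∣p∣ ⁅ x ⁆) (cong (n ∸_) (∣⁅x⁆∣≡1 x))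

∣∁⁅x⁆-y∣<n∸1 : ∀ {n} {x y : Fin n} → x ≢ y → ∣ ∁ ⁅ x ⁆ - y ∣ < n ∸ 1
∣∁⁅x⁆-y∣<n∸1 {x = x} {y} x≢y =
  subst (∣ ∁ ⁅ x ⁆ - y ∣ <_) (∣∁⁅x⁆∣≡n∸1 x) (x∈p⇒∣p-x∣<∣p∣ (x∈∁⁅y⁆⁺ (x≢y ∘ sym)))

transpose-sends-right-to-left : ∀ {n} (x y : Fin n) → y ≢ x → transpose x y y ≡ x
transpose-sends-right-to-left x y y≢x
  rewrite dec-false (y ≟ x) y≢x | dec-true (y ≟ y) refl = refl

transpose-fixes : ∀ {n} (x y s : Fin n) → s ≢ x → s ≢ y → transpose x y s ≡ s
transpose-fixes x y s s≢x s≢y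
  rewrite dec-false (s ≟ x) s≢x | dec-false (s ≟ y) s≢y = refl

transpose-injective : ∀ {n} (x y : Fin n) → Injective _≡_ _≡_ (transpose x y)
transpose-injective x y {u} {v} eq = begin
  u                                     ≡⟨ sym (transpose-inverse y x) ⟩
  transpose y x (transpose x y u) ≡⟨ cong (transpose y x) eq ⟩
  transpose y x (transpose x y v) ≡⟨ transpose-inverse y x ⟩
  v                                     ∎
  where open ≡-Reasoning

module _ {n k} (G : Graph n) (c : Colouring n k) where

  no-determining-⊂⇒critical : ∀ S → Determining G c S →
    ¬ (∃[ T ] T ⊂ S × Determining G c T) → Critical G c S
  no-determining-⊂⇒critical S det none =
    det , λ T T⊆S detT → ⊆-antisym T⊆S (S⊆T T⊆S detT)
    where
    S⊆T : ∀ {T} → T ⊆ S → Determining G c T → S ⊆ T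
    S⊆T {T} T⊆S detT {y} y∈S with y ∈? T
    ... | yes y∈T = y∈T
    ... | no y∉T = contradiction (T , ((λ {z} → T⊆S {z}) , y , y∈S , y∉T) , detT) none

  -- Being determining is not decidable here, so minimising only succeeds under ¬ ¬;
  -- this suffices because it is used to derive a contradiction.
  determining⇒¬¬critical⊆ : ∀ S → Determining G c S →
                            ¬ ¬ (∃[ T ] T ⊆ S × Critical G c T)
  determining⇒¬¬critical⊆ S = shrink S (<-wellFounded ∣ S ∣)
    where
    shrink : ∀ S → Acc _<_ ∣ S ∣ → Determining G c S →
             ¬ ¬ (∃[ T ] T ⊆ S × Critical G c T)
    shrink S (acc smaller) det noCritical =
      ¬¬-excluded-middle {A = ∃[ T ] T ⊂ S × Determining G c T} λ where
        (yes (T , T⊂S , detT)) → shrink T (smaller (p⊂q⇒∣p∣<∣q∣ T⊂S)) detT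
          λ (U , U⊆T , critU) → noCritical (U , ⊆-trans U⊆T (p⊂q⇒p⊆q T⊂S) , critU)
        (no none) → noCritical (S , ⊆-refl , no-determining-⊂⇒critical S det none)

  ScsIs-unique : ∀ {m m'} → ScsIs G c m → ScsIs G c m' → m ≡ m'
  ScsIs-unique ((S , critS , ∣S∣≡m) , minimum) ((S' , critS' , ∣S'∣≡m') , minimum') =
    ℕ.≤-antisym (subst (_ ≤_) ∣S'∣≡m' (minimum S' critS'))
                (subst (_ ≤_) ∣S∣≡m (minimum' S critS))

module _ {n k} (G : Graph n) {m} (colourable : Colourable G k)
         (constant : ∀ (c : Colouring n k) → Proper G c → ScsIs G c m) where

  colouring-with-scs : ∃[ c ] Proper G c × ScsIs G c m
  colouring-with-scs = let c₀ , proper₀ = colourable in c₀ , proper₀ , constant c₀ proper₀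

  constant-scs⇒SnIs : SnIs G k m
  constant-scs⇒SnIs = colouring-with-scs ,
    λ c _ proper scs → ℕ.≤-reflexive (ScsIs-unique G c (constant c proper) scs)

  constant-scs⇒ScsBarIs : ScsBarIs G k m
  constant-scs⇒ScsBarIs = colouring-with-scs ,
    λ c _ proper scs → ℕ.≤-reflexive (ScsIs-unique G c scs (constant c proper))

module _ {n} (G : Graph n) (complete : IsComplete G) {k} {c : Colouring n k}
         (proper : Proper G c) where

  proper⇒injective : Injective _≡_ _≡_ c
  proper⇒injective {u} {v} cu≡cv with u ≟ v
  ... | yes u≡v = u≡v
  ... | no u≢v = contradiction cu≡cv (proper u v (complete u v u≢v))

  determining⇒∁⁅x⁆⊆ : ∀ {T x} → Determining G c T → x ∉ T → ∁ ⁅ x ⁆ ⊆ T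
  determining⇒∁⁅x⁆⊆ {T} {x} det x∉T {y} y∈∁⁅x⁆ with y ∈? T
  ... | yes y∈T = y∈T
  ... | no y∉T = contradiction (proper⇒injective cy≡cx) (x∈∁⁅y⁆⁻ y∈∁⁅x⁆)
    where
    y≢x = x∈∁⁅y⁆⁻ y∈∁⁅x⁆
    swap = transpose y x
    swap-proper : Proper G (c ∘ swap)
    swap-proper = injective⇒proper G (transpose-injective y x ∘ proper⇒injective)
    swap-agrees : ∀ s → s ∈ T → c (swap s) ≡ c s
    swap-agrees s s∈T = cong c (transpose-fixes y x s (λ { refl → y∉T s∈T })
                                                      (λ { refl → x∉T s∈T }))
    cy≡cx : c y ≡ c x
    cy≡cx = begin
      c y          ≡⟨ cong c (transpose-sends-right-to-left y x (y≢x ∘ sym)) ⟨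
      c (swap x)   ≡⟨ det (c ∘ swap) swap-proper swap-agrees x ⟩
      c x          ∎
      where open ≡-Reasoning

  determining⇒n∸1≤ : ∀ {S} → Determining G c S → n ∸ 1 ≤ ∣ S ∣
  determining⇒n∸1≤ {S} det with any? (λ x → ¬? (x ∈? S))
  ... | yes (x , x∉S) =
    subst (_≤ ∣ S ∣) (∣∁⁅x⁆∣≡n∸1 x) (p⊆q⇒∣p∣≤∣q∣ (determining⇒∁⁅x⁆⊆ det x∉S))
  ... | no none-missing =
    ℕ.≤-trans (ℕ.m∸n≤m n 1) (subst (_≤ ∣ S ∣) (∣⊤∣≡n n) (p⊆q⇒∣p∣≤∣q∣ ⊤⊆S))
    where
    ⊤⊆S : ⊤ ⊆ S
    ⊤⊆S {y} _ = decidable-stable (y ∈? S) (λ y∉S → none-missing (y , y∉S))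

module _ {n} (G : Graph n) (complete : IsComplete G)
         {χ} (chromatic : IsChromaticNumber G χ) {c : Colouring n χ} (proper : Proper G c) where

  ∁⁅x⁆-determining : ∀ x → Determining G c (∁ ⁅ x ⁆)
  ∁⁅x⁆-determining x c' proper' agree v with v ≟ x
  ... | no v≢x = agree v (x∈∁⁅y⁆⁺ v≢x)
  ... | yes refl = forced-colour {G = G} proper' v (c v) seen
    where
    seen : ∀ a → a ≢ c v → ∃[ z ] Adjacent G v z × c' z ≡ a
    seen a a≢cv =
      let z , cz≡a = injective⇒surjective (chromatic≤order {G = G} chromatic) c
                       (proper⇒injective G complete proper) a
          z≢v : z ≢ v
          z≢v = λ z≡v → a≢cv (trans (sym cz≡a) (cong c z≡v))
      in z , complete v z (z≢v ∘ sym) , trans (agree z (x∈∁⁅y⁆⁺ z≢v)) cz≡a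

  ∁⁅x⁆-critical : ∀ x → Critical G c (∁ ⁅ x ⁆)
  ∁⁅x⁆-critical x = ∁⁅x⁆-determining x , minimal
    where
    minimal : ∀ T → T ⊆ ∁ ⁅ x ⁆ → Determining G c T → T ≡ ∁ ⁅ x ⁆
    minimal T T⊆∁⁅x⁆ detT = ⊆-antisym T⊆∁⁅x⁆ (determining⇒∁⁅x⁆⊆ G complete proper detT x∉T)
      where
      x∉T : x ∉ T
      x∉T x∈T = x∈∁⁅y⁆⁻ (T⊆∁⁅x⁆ x∈T) refl

complete⇒critical-of-size-n∸1 :
  ∀ {n} (G : Graph n) → IsComplete G → ∀ {χ} → IsChromaticNumber G χ →
  ∀ {c : Colouring n χ} → Proper G c → ∃[ S ] Critical G c S × ∣ S ∣ ≡ n ∸ 1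
complete⇒critical-of-size-n∸1 {zero} G _ _ _ =
  [] , ((λ _ _ _ ()) , λ { [] _ _ → refl }) , refl
complete⇒critical-of-size-n∸1 {suc _} G complete chromatic proper =
  ∁ ⁅ zero ⁆ , ∁⁅x⁆-critical G complete chromatic proper zero , ∣∁⁅x⁆∣≡n∸1 zero

complete⇒scs≡n∸1 : ∀ {n} (G : Graph n) → IsComplete G → ∀ {χ} → IsChromaticNumber G χ →
                   ∀ c → Proper G c → ScsIs G c (n ∸ 1)
complete⇒scs≡n∸1 G complete chromatic c proper =
  complete⇒critical-of-size-n∸1 G complete chromatic proper ,
  λ S critS → determining⇒n∸1≤ G complete proper (proj₁ critS)

avoided-colour⇒colourable : ∀ {n k} (G : Graph n) {c : Colouring n (suc k)} →
                            Proper G c → ∀ i → (∀ v → c v ≢ i) → Colourable G k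
avoided-colour⇒colourable G proper i avoids =
  (λ v → punchOut (i≢c v)) ,
  λ u v uv eq → proper u v uv (punchOut-injective (i≢c u) (i≢c v) eq)
  where
  i≢c = λ v → avoids v ∘ sym

module _ {n k} (G : Graph n) (c : Colouring n k) where

  SeesColour : Fin n → Fin k → Set
  SeesColour x a = ∃[ z ] Adjacent G x z × c z ≡ a

  seesColour? : ∀ x a → Dec (SeesColour x a)
  seesColour? x a = any? (λ z → (Adj G x z ≟ᵇ true) ×-dec (c z ≟ a))

  BVertex : Fin n → Set
  BVertex x = ∀ a → a ≢ c x → SeesColour x a

  bVertex? : ∀ x → Dec (BVertex x)
  bVertex? x = all? (λ a → ¬? (a ≟ c x) →-dec seesColour? x a)

  ¬BVertex⇒missing-colour : ∀ {x} → ¬ BVertex x → ∃[ a ] a ≢ c x × ¬ SeesColour x a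
  ¬BVertex⇒missing-colour {x} ¬bx =
    let a , ¬seen = ¬∀⟶∃¬ k _ (λ a → ¬? (a ≟ c x) →-dec seesColour? x a) ¬bx
    in a , (λ a≡cx → ¬seen (λ a≢cx → contradiction a≡cx a≢cx)) ,
       (λ sees → ¬seen (λ _ → sees))

  BVertexAvoiding : Fin n → Fin n → Set
  BVertexAvoiding y x = ∀ a → a ≢ c x → ∃[ z ] Adjacent G x z × z ≢ y × c z ≡ a

  walk⇒edge-into-BVertex : ∀ {w t} → Reach G w t → ¬ BVertex w → BVertex t →
                           ∃₂ λ p q → Adjacent G p q × ¬ BVertex p × BVertex q
  walk⇒edge-into-BVertex here ¬bw bt = contradiction bt ¬bw
  walk⇒edge-into-BVertex (step {w = w'} ww' walk) ¬bw bt with bVertex? w'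
  ... | yes bw' = _ , _ , ww' , ¬bw , bw'
  ... | no ¬bw' = walk⇒edge-into-BVertex walk ¬bw' bt

  BVertexPair : Set
  BVertexPair = ∃₂ λ x y → x ≢ y × BVertexAvoiding y x × BVertex y

  non-edge-of-BVertices⇒BVertexPair : ∀ {u v} → u ≢ v → Adj G u v ≡ false →
                                      BVertex u → BVertex v → BVertexPair
  non-edge-of-BVertices⇒BVertexPair {u} {v} u≢v uv≡false bu bv = u , v , u≢v , avoid , bv
    where
    avoid : BVertexAvoiding v u
    avoid a a≢cu =
      let z , uz , cz≡a = bu a a≢cu
      in z , uz , (λ { refl → contradiction (trans (sym uz) uv≡false) λ () }) , cz≡a

  module _ (proper : Proper G c) where

    ∁⁅x⁆-y-determining : ∀ {x y} → BVertexAvoiding y x → BVertex y →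
                         Determining G c (∁ ⁅ x ⁆ - y)
    ∁⁅x⁆-y-determining {x} {y} avoid by c' proper' agree = agrees
      where
      off-xy : ∀ {z} → z ≢ x → z ≢ y → c' z ≡ c z
      off-xy z≢x z≢y = agree _ (x∈p∧x≢y⇒x∈p-y (x∈∁⁅y⁆⁺ z≢x) z≢y)
      at-x : c' x ≡ c x
      at-x = forced-colour {G = G} proper' x (c x) λ a a≢cx →
        let z , xz , z≢y , cz≡a = avoid a a≢cx
        in z , xz , trans (off-xy (adjacent⇒≢ G xz ∘ sym) z≢y) cz≡a
      off-y : ∀ z → z ≢ y → c' z ≡ c z
      off-y z z≢y with z ≟ x
      ... | yes refl = at-x
      ... | no z≢x = off-xy z≢x z≢y
      agrees : ∀ v → c' v ≡ c v
      agrees v with v ≟ y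
      ... | no v≢y = off-y v v≢y
      ... | yes refl = forced-colour {G = G} proper' v (c v) λ a a≢cv →
        let z , vz , cz≡a = by a a≢cv
        in z , vz , trans (off-y z (adjacent⇒≢ G vz ∘ sym)) cz≡a

    -- Colour class i is independent, so moving each of its vertices to a colour missing
    -- around it creates no conflict.
    recolour-class : ∀ i → (∀ v → c v ≡ i → ¬ BVertex v) →
                     ∃[ c' ] Proper G c' × ∀ v → c' v ≢ i
    recolour-class i no-b = c' , proper' , avoids
      where
      missing : ∀ v → c v ≡ i → ∃[ a ] a ≢ c v × ¬ SeesColour v a
      missing v cv≡i = ¬BVertex⇒missing-colour (no-b v cv≡i)
      recolour : ∀ v → Dec (c v ≡ i) → Fin k
      recolour v (yes cv≡i) = proj₁ (missing v cv≡i)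
      recolour v (no _) = c v
      c' : Colouring n k
      c' v = recolour v (c v ≟ i)
      avoids : ∀ v → c' v ≢ i
      avoids v with c v ≟ i
      ... | yes cv≡i = λ a≡i → proj₁ (proj₂ (missing v cv≡i)) (trans a≡i (sym cv≡i))
      ... | no cv≢i = cv≢i
      proper' : Proper G c'
      proper' u v uv with c u ≟ i | c v ≟ i
      ... | yes cu≡i | yes cv≡i = λ _ → proper u v uv (trans cu≡i (sym cv≡i))
      ... | yes cu≡i | no _ =
        λ a≡cv → proj₂ (proj₂ (missing u cu≡i)) (v , uv , sym a≡cv)
      ... | no _ | yes cv≡i =
        λ cu≡a → proj₂ (proj₂ (missing v cv≡i)) (u , trans (Graph.sym G v u) uv , cu≡a)
      ... | no _ | no _ = proper u v uv

chromatic⇒BVertex-in-class : ∀ {n} (G : Graph n) {χ} → IsChromaticNumber G χ →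
                             ∀ {c : Colouring n χ} → Proper G c →
                             ∀ i → ∃[ v ] c v ≡ i × BVertex G c v
chromatic⇒BVertex-in-class G {suc χ} (_ , fewer-fail) {c} proper i
  with any? (λ v → (c v ≟ i) ×-dec bVertex? G c v)
... | yes found = found
... | no none =
  let c' , proper' , avoids =
        recolour-class G c proper i (λ v cv≡i bv → none (v , cv≡i , bv))
  in contradiction (avoided-colour⇒colourable G proper' i avoids) (fewer-fail χ ℕ.≤-refl)

module _ {n} (G : Graph n) {χ} (chromatic : IsChromaticNumber G χ)
         {c : Colouring n χ} (proper : Proper G c) where

  edge-into-BVertex⇒BVertexPair : ∀ {p q} → Adjacent G p q → ¬ BVertex G c p →
                                  BVertex G c q → BVertexPair G c
  edge-into-BVertex⇒BVertexPair {p} {q} pq ¬bp bq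
    with chromatic⇒BVertex-in-class G chromatic proper (c p)
  ... | y , cy≡cp , by = q , y , q≢y , avoid , by
    where
    q≢y : q ≢ y
    q≢y q≡y = proper p q pq (trans (sym cy≡cp) (cong c (sym q≡y)))
    avoid : BVertexAvoiding G c y q
    avoid a a≢cq with bq a a≢cq
    ... | z , qz , cz≡a with z ≟ y
    ...   | no z≢y = z , qz , z≢y , cz≡a
    ...   | yes refl =
      -- y was the only witness at q for colour a = c p; the neighbour p ≠ y replaces it
      p , trans (Graph.sym G q p) pq , (λ { refl → ¬bp by }) , trans (sym cy≡cp) cz≡a

  connected-non-edge⇒BVertexPair : Connected G → ∀ {u v} → u ≢ v → Adj G u v ≡ false →
                                   BVertexPair G c
  connected-non-edge⇒BVertexPair connected {u} {v} u≢v uv≡false with all? (bVertex? G c)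
  ... | yes all-b = non-edge-of-BVertices⇒BVertexPair G c u≢v uv≡false (all-b u) (all-b v)
  ... | no not-all-b =
    let w , ¬bw = ¬∀⟶∃¬ n _ (bVertex? G c) not-all-b
        b , _ , bb = chromatic⇒BVertex-in-class G chromatic proper (c w)
        _ , _ , pq , ¬bp , bq = walk⇒edge-into-BVertex G c (connected w b) ¬bw bb
    in edge-into-BVertex⇒BVertexPair pq ¬bp bq

scs≡n∸1⇒complete : ∀ {n} (G : Graph n) → Connected G → ∀ {χ} → IsChromaticNumber G χ →
                   ∀ {c : Colouring n χ} → Proper G c → ScsIs G c (n ∸ 1) → IsComplete G
scs≡n∸1⇒complete G connected chromatic {c} proper (_ , minimum) u v u≢v
  with Adj G u v in uv
... | true = refl
... | false =
  let x , y , x≢y , avoid , by =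
        connected-non-edge⇒BVertexPair G chromatic proper connected u≢v uv
  in ⊥-elim (determining⇒¬¬critical⊆ G c _ (∁⁅x⁆-y-determining G c proper avoid by)
       λ (T , T⊆ , critT) →
         ℕ.<⇒≱ (∣∁⁅x⁆-y∣<n∸1 x≢y) (ℕ.≤-trans (minimum T critT) (p⊆q⇒∣p∣≤∣q∣ T⊆)))

mainTheorem1 : ∀ (n : ℕ) (G : Graph n) → Connected G →
    ∀ (χ : ℕ) → IsChromaticNumber G χ →
      (SnIs G χ (n ∸ 1) ⇔ IsComplete G) × (ScsBarIs G χ (n ∸ 1) ⇔ IsComplete G)
mainTheorem1 n G connected χ chromatic =
  mk⇔ (λ ((_ , proper , scs) , _) → complete-from-scs proper scs)
      (λ complete → constant-scs⇒SnIs G colourable (complete⇒scs≡n∸1 G complete chromatic)) ,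
  mk⇔ (λ ((_ , proper , scs) , _) → complete-from-scs proper scs)
      (λ complete → constant-scs⇒ScsBarIs G colourable (complete⇒scs≡n∸1 G complete chromatic))
  where
  colourable = proj₁ chromatic
  complete-from-scs = scs≡n∸1⇒complete G connected chromatic
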